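{- Let $\mathcal{A}=(A_0,A_1,\mathcal{F})$ with $\mathcal{F}=\mathcal{G}_0\cup\mathcal{G}_1\cup\{h\}$, where: - $\mathcal{G}_0$ consists of operations on $A_0$; - $\mathcal{G}_1$ consists of operations on $A_1$; - $h:A_1\to A_0$ is a homomorphism from $(A_1,\mathcal{G}_1)$ into $(A_0,\mathcal{G}_0)$. Let $\vec{\beta}\in{}^\omega\mathrm{im}(h)$ and $\vec{e}\in\Omega_0$. Let $\vec{b}$ be an $\vec{e}$-sorted sequence such that $\vec{\beta}(i)=h(\vec{b}(i))$ if $\vec{e}(i)=1$, and $\vec{b}(i)=\vec{\beta}(i)$ otherwise. Then: 1. If $f\in\mathrm{OT}(\mathcal{F})$ is $N$-ary with codomain $A_0$, then for each $n_1<\cdots<n_N$ such that $(\vec{b}(n_1),\dots,\vec{b}(n_N))$ lies in the domain of $f$, there exists $F'\in\mathrm{OT}(\mathcal{G}_0)$ with $f(\vec{b}(n_1),\dots,\vec{b}(n_N))=F'(\vec{\beta}(n_1),\dots,\vec{\beta}(n_N))$. 2. If $\vec{u}\le_\mathcal{F}\vec{b}$ and $\vec{u}\in{}^\omega A_0$, then $\vec{u}\le_{\mathcal{G}_0}\vec{\beta}$.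
   Context: An algebra is a pair $(\{A_\xi\}_{\xi\in I},\mathcal{F})$ with nonempty, pairwise disjoint phyla and a family $\mathcal{F}$ of operations, each with domain a finite product of phyla and codomain a phylum. An operation "on $A_i$" has all arguments and values in $A_i$. A sort is $\vec{e}\in{}^\omega I$, and $\vec{b}$ is $\vec{e}$-sorted if $\vec{b}(i)\in A_{\vec{e}(i)}$ for all $i$. Orderly terms: $\mathcal{F}_0=\mathcal{F}\cup\{\mathrm{id}_{A_\xi}\}$. $\mathcal{F}_{k+1}$ is $\mathcal{F}_k$ plus all $f$ with $f(\vec{x})=g(h_1(\vec{x}_1),\dots,h_N(\vec{x}_N))$, where $g\in\mathcal{F}$ is $N$-ary, $h_i\in\mathcal{F}_k$, and $\vec{x}_1\ast\cdots\ast\vec{x}_N=\vec{x}$ is the argument list of $f$ (concatenation). $\mathrm{OT}(\mathcal{F})=\bigcup_k\mathcal{F}_k$, and similarly $\mathrm{OT}(\mathcal{G}_0)$. $\vec{a}\le_\mathcal{F}\vec{b}$ means: for each $j$ there are a finite subsequence $\vec{b}_j$ of $\vec{b}$ and $f_j\in\mathrm{OT}(\mathcal{F})$ with $\vec{a}(j)=f_j(\vec{b}_j)$, and $\vec{b}_0\ast\vec{b}_1\ast\cdots$ is a subsequence of $\vec{b}$; $\le_{\mathcal{G}_0}$ is defined likewise with $\mathcal{G}_0$. $\Omega$ is the set of sorts each of whose values is taken infinitely often, and $\Omega_0=\{\vec{e}\in\Omega:\vec{e}(0)=0\}$. Homomorphism: there is an arity-preserving bijection between $\mathcal{G}_1$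 and $\mathcal{G}_0$, and for each $n$-ary $F\in\mathcal{G}_1$ with corresponding $f\in\mathcal{G}_0$ and all $a_i\in A_1$, $h(F(a_1,\dots,a_n))=f(h(a_1),\dots,h(a_n))$. -}

module Defs where

open import Data.Nat using (ℕ; _<_; _≤_)
open import Data.Fin using (Fin; zero; suc)
open import Data.List using (List; []; _∷_; _++_; map; replicate)
open import Data.List.Relation.Unary.All using (All; []; _∷_)
open import Data.List.Relation.Unary.All.Properties using (++⁻)
open import Data.List.Relation.Unary.Linked using (Linked)
open import Data.Vec as Vec using (Vec)
open import Data.Product using (Σ; ∃; _×_; _,_; proj₁; proj₂)
open import Function.Bundles using (_⤖_; Bijection)
open import Relation.Binary.PropositionalEquality using (_≡_)

-- Orderly terms: identities (var), and g(h₁,…,h_N) whose argument list is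
-- the concatenation of the argument lists of the h_i (each variable used
-- exactly once, in order).

module Terms {S : Set} (Op : List S → S → Set) where

  data Term : List S → S → Set
  data Terms : List S → List S → Set

  data Term where
    var : (s : S) → Term (s ∷ []) s
    app : ∀ {as ss s} → Op ss s → Terms as ss → Term as s

  data Terms where
    []  : Terms [] []
    _∷_ : ∀ {a as s ss} → Term a s → Terms as ss → Terms (a ++ as) (s ∷ ss)

  module Eval (Car : S → Set) (⟦_⟧ : ∀ {ss s} → Op ss s → All Car ss → Car s) where

    eval  : ∀ {as s} → Term as s → All Car as → Car s
    evals : ∀ {as ss} → Terms as ss → All Car as → All Car ss
    eval (var s) (x ∷ []) = x
    eval (app o ts) env = ⟦ o ⟧ (evals ts env)
    evals [] [] = []
    evals (_∷_ {a} t ts) env =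
      eval t (proj₁ (++⁻ a env)) ∷ evals ts (proj₂ (++⁻ a env))

    select : (e : ℕ → S) (b : (i : ℕ) → Car (e i)) (idx : List ℕ) → All Car (map e idx)
    select e b [] = []
    select e b (i ∷ is) = b i ∷ select e b is

    -- one block: a(j) = f_j(b_j), b_j a finite subsequence of b (strictly
    -- increasing index list) and f_j an orderly term
    record Block (e : ℕ → S) (b : (i : ℕ) → Car (e i)) (t : S) (x : Car t) : Set where
      field
        idx  : List ℕ
        incr : Linked _<_ idx
        term : Term (map e idx) t
        eqn  : x ≡ eval term (select e b idx)

    open Block public

    -- a ≤ b : blocks for every j whose concatenation b₀ ∗ b₁ ∗ ⋯ is a
    -- subsequence of b (indices of earlier blocks precede those of later ones)
    Below : (d : ℕ → S) (a : (j : ℕ) → Car (d j))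
            (e : ℕ → S) (b : (i : ℕ) → Car (e i)) → Set
    Below d a e b =
      Σ ((j : ℕ) → Block e b (d j) (a j)) λ B →
        (j j′ : ℕ) → j < j′ →
          All (λ x → All (λ y → x < y) (idx (B j′))) (idx (B j))

InΩ : (ℕ → Fin 2) → Set
InΩ e = (i m : ℕ) → ∃ λ j → m ≤ j × e j ≡ e i

InΩ₀ : (ℕ → Fin 2) → Set
InΩ₀ e = InΩ e × e 0 ≡ zero

record TwoPhyla : Set₁ where
  field
    A₀ A₁ : Set
    G₀ G₁ : ℕ → Set
    op₀   : ∀ {n} → G₀ n → Vec A₀ n → A₀
    op₁   : ∀ {n} → G₁ n → Vec A₁ n → A₁
    h     : A₁ → A₀

module Alg (𝒜 : TwoPhyla) where
  open TwoPhyla 𝒜 public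

  -- h is a homomorphism (A₁,𝒢₁) → (A₀,𝒢₀): an arity-preserving bijection
  -- 𝒢₁ ≅ 𝒢₀ (a bijection in each arity) commuting with h.
  IsHomomorphism : Set
  IsHomomorphism =
    Σ ((n : ℕ) → G₁ n ⤖ G₀ n) λ σ →
      ∀ {n} (F : G₁ n) (xs : Vec A₁ n) →
        h (op₁ F xs) ≡ op₀ (Bijection.to (σ n) F) (Vec.map h xs)

  Car : Fin 2 → Set
  Car zero    = A₀
  Car (suc _) = A₁

  toVec : ∀ n → All Car (replicate n zero) → Vec A₀ n
  toVec ℕ.zero [] = Vec.[]
  toVec (ℕ.suc n) (x ∷ xs) = x Vec.∷ toVec n xs

  toVec₁ : ∀ n → All Car (replicate n (suc zero)) → Vec A₁ n
  toVec₁ ℕ.zero [] = Vec.[]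
  toVec₁ (ℕ.suc n) (x ∷ xs) = x Vec.∷ toVec₁ n xs

  data FOp : List (Fin 2) → Fin 2 → Set where
    g₀ : ∀ {n} → G₀ n → FOp (replicate n zero) zero
    g₁ : ∀ {n} → G₁ n → FOp (replicate n (suc zero)) (suc zero)
    hₒ : FOp (suc zero ∷ []) zero

  data GOp : List (Fin 2) → Fin 2 → Set where
    g₀ : ∀ {n} → G₀ n → GOp (replicate n zero) zero

  ⟦_⟧F : ∀ {ss s} → FOp ss s → All Car ss → Car s
  ⟦ g₀ {n} g ⟧F xs = op₀ g (toVec n xs)
  ⟦ g₁ {n} g ⟧F xs = op₁ g (toVec₁ n xs)
  ⟦ hₒ ⟧F (x ∷ []) = h x

  ⟦_⟧G : ∀ {ss s} → GOp ss s → All Car ss → Car s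
  ⟦ g₀ {n} g ⟧G xs = op₀ g (toVec n xs)

  module 𝓕 = Terms FOp
  module 𝓖 = Terms GOp
  module E𝓕 = 𝓕.Eval Car ⟦_⟧F
  module E𝓖 = 𝓖.Eval Car ⟦_⟧G

  Matches : (s : Fin 2) → Car s → A₀ → Set
  Matches zero    x y = x ≡ y
  Matches (suc _) x y = y ≡ h x

module Submission where

-- Since h is a homomorphism, every orderly ℱ-term can be
-- rewritten as an orderly 𝒢₀-term over the same variables: replace each
-- operation of 𝒢₁ by the corresponding operation of 𝒢₀, delete each
-- occurrence of h, and give every variable sort 0.  If the inputs of the
-- ℱ-term are b(n₁),…,b(n_N) and those of the 𝒢₀-term are β(n₁),…,β(n_N),
-- with β(i) = b(i) on sort 0 and β(i) = h(b(i)) on sort 1, then by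
-- induction on terms the two values agree in the same sense: equal at
-- sort 0, related by h at sort 1.  Part 1 is this invariant at the value
-- sort 0, and part 2 follows by translating every block of a witness of
-- u ≤_ℱ b, keeping its index list, hence its ordering.

open import Defs
open import Data.Nat using (ℕ; _<_)
open import Data.Fin using (Fin; zero; suc)
open import Data.List using (List; []; _∷_; _++_; map; replicate)
open import Data.List.Properties using (map-++; map-replicate; map-∘; ++-identityʳ)
open import Data.List.Relation.Unary.All using (All; []; _∷_)
open import Data.List.Relation.Unary.All.Properties using (++⁻)
open import Data.List.Relation.Unary.Linked using (Linked)
open import Data.Product using (∃; _×_; _,_; proj₁; proj₂)
open import Relation.Binary.PropositionalEquality using (_≡_; refl; sym; trans; cong; cong₂; subst)
open import Function.Bundles using (Bijection)
import Data.Vec as Vec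

-- This is how casts on the index lists of terms are evaluated.
run-subst : {I C : Set} (T E : I → Set) (run : ∀ {l} → T l → E l → C)
            {l l′ : I} (q : l ≡ l′) (t : T l′) (xs : E l) →
            run (subst T (sym q) t) xs ≡ run t (subst E q xs)
run-subst T E run refl t xs = refl

zeros : {A : Set} → List A → List (Fin 2)
zeros = map (λ _ → zero)

zeros-replicate : {A : Set} (n : ℕ) (x : A) → zeros (replicate n x) ≡ replicate n zero
zeros-replicate n x = map-replicate (λ _ → zero) n x

zeros-++ : {A : Set} (xs ys : List A) → zeros (xs ++ ys) ≡ zeros xs ++ zeros ys
zeros-++ = map-++ (λ _ → zero)

zeros-++[] : {A : Set} (xs : List A) → zeros (xs ++ []) ≡ zeros xs
zeros-++[] xs = cong zeros (++-identityʳ xs)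

zeros-map : {A B : Set} (f : A → B) (xs : List A) → zeros xs ≡ zeros (map f xs)
zeros-map f xs = map-∘ xs

module Agreement (𝒜 : TwoPhyla) where
  open Alg 𝒜

  data Agree : (as bs : List (Fin 2)) → All Car as → All Car bs → Set where
    []  : Agree [] [] [] []
    _∷_ : ∀ {s as bs x xs} {y : A₀} {ys} →
          Matches s x y → Agree as bs xs ys →
          Agree (s ∷ as) (zero ∷ bs) (x ∷ xs) (y ∷ ys)

  agree-subst : ∀ {as bs bs′ xs ys} (q : bs ≡ bs′) → Agree as bs xs ys →
                Agree as bs′ xs (subst (All Car) q ys)
  agree-subst refl r = r

  agree-++⁻ : ∀ a {as ds} (xs : All Car (a ++ as)) (ys : All Car (zeros a ++ ds)) →
              Agree (a ++ as) (zeros a ++ ds) xs ys →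
              Agree a (zeros a) (proj₁ (++⁻ a xs)) (proj₁ (++⁻ (zeros a) ys))
              × Agree as ds (proj₂ (++⁻ a xs)) (proj₂ (++⁻ (zeros a) ys))
  agree-++⁻ []      xs       ys       r        = [] , r
  agree-++⁻ (s ∷ a) (x ∷ xs) (y ∷ ys) (m ∷ r) =
    let (r₁ , r₂) = agree-++⁻ a xs ys r in (m ∷ r₁) , r₂

  agree-++[] : ∀ a {bs} (xs : All Car (a ++ [])) {ys : All Car bs} →
               Agree (a ++ []) bs xs ys → Agree a bs (proj₁ (++⁻ a xs)) ys
  agree-++[] []      []       []      = []
  agree-++[] (s ∷ a) (x ∷ xs) (m ∷ r) = m ∷ agree-++[] a xs r

  agree-toVec : ∀ n {xs ys} → Agree (replicate n zero) (replicate n zero) xs ys →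
                toVec n xs ≡ toVec n ys
  agree-toVec ℕ.zero    []      = refl
  agree-toVec (ℕ.suc n) (m ∷ r) = cong₂ Vec._∷_ m (agree-toVec n r)

  agree-toVec₁ : ∀ n {xs ys} → Agree (replicate n (suc zero)) (replicate n zero) xs ys →
                 Vec.map h (toVec₁ n xs) ≡ toVec n ys
  agree-toVec₁ ℕ.zero    []      = refl
  agree-toVec₁ (ℕ.suc n) (m ∷ r) = cong₂ Vec._∷_ (sym m) (agree-toVec₁ n r)

module Translation (𝒜 : TwoPhyla) (hom : Alg.IsHomomorphism 𝒜) where
  open Alg 𝒜
  open Agreement 𝒜

  σ : ∀ {n} → G₁ n → G₀ n
  σ {n} = Bijection.to (proj₁ hom n)

  castOp : ∀ n (s : Fin 2) → G₀ n → GOp (zeros (replicate n s)) zero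
  castOp n s g = subst (λ l → GOp l zero) (sym (zeros-replicate n s)) (g₀ g)

  erase  : ∀ {as s} → 𝓕.Term as s → 𝓖.Term (zeros as) zero
  erases : ∀ {as ss} → 𝓕.Terms as ss → 𝓖.Terms (zeros as) (zeros ss)
  erase (𝓕.var s)                             = 𝓖.var zero
  erase (𝓕.app (g₀ {n} g) ts)                 = 𝓖.app (castOp n zero g) (erases ts)
  erase (𝓕.app (g₁ {n} g) ts)                 = 𝓖.app (castOp n (suc zero) (σ g)) (erases ts)
  erase (𝓕.app hₒ (𝓕._∷_ {a} t 𝓕.[]))         =
    subst (λ l → 𝓖.Term l zero) (sym (zeros-++[] a)) (erase t)
  erases 𝓕.[]                                 = 𝓖.[]
  erases {ss = _ ∷ ss} (𝓕._∷_ {a} {as} t ts)  =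
    subst (λ l → 𝓖.Terms l (zero ∷ zeros ss)) (sym (zeros-++ a as)) (erase t 𝓖.∷ erases ts)

  eval-h : ∀ {a} (t : 𝓕.Term a (suc zero)) (xs : All Car (a ++ [])) →
           E𝓕.eval (𝓕.app hₒ (t 𝓕.∷ 𝓕.[])) xs ≡ h (E𝓕.eval t (proj₁ (++⁻ a xs)))
  eval-h {a} t xs with ++⁻ a xs
  ... | (_ , []) = refl

  sound  : ∀ {as s} (t : 𝓕.Term as s) {xs ys} → Agree as (zeros as) xs ys →
           Matches s (E𝓕.eval t xs) (E𝓖.eval (erase t) ys)
  sounds : ∀ {as ss} (ts : 𝓕.Terms as ss) {xs ys} → Agree as (zeros as) xs ys →
           Agree ss (zeros ss) (E𝓕.evals ts xs) (E𝓖.evals (erases ts) ys)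
  sound (𝓕.var s) (m ∷ []) = m
  sound (𝓕.app (g₀ {n} g) ts) {ys = ys} r =
    trans (cong (op₀ g) (agree-toVec n (agree-subst q (sounds ts r))))
          (sym (run-subst (λ l → GOp l zero) (All Car) ⟦_⟧G q (g₀ g) (E𝓖.evals (erases ts) ys)))
    where q : zeros (replicate n zero) ≡ replicate n zero
          q = zeros-replicate n zero
  sound (𝓕.app (g₁ {n} g) ts) {ys = ys} r =
    trans (run-subst (λ l → GOp l zero) (All Car) ⟦_⟧G q (g₀ (σ g)) (E𝓖.evals (erases ts) ys))
      (trans (cong (op₀ (σ g)) (sym (agree-toVec₁ n (agree-subst q (sounds ts r)))))
             (sym (proj₂ hom g _)))
    where q : zeros (replicate n (suc zero)) ≡ replicate n zero
          q = zeros-replicate n (suc zero)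
  sound (𝓕.app hₒ (𝓕._∷_ {a} t 𝓕.[])) {xs} {ys} r =
    trans (eval-h t xs)
      (trans (sym (sound t (agree-++[] a xs (agree-subst q r))))
             (sym (run-subst (λ l → 𝓖.Term l zero) (All Car) E𝓖.eval q (erase t) ys)))
    where q : zeros (a ++ []) ≡ zeros a
          q = zeros-++[] a
  sounds 𝓕.[] [] = []
  sounds {ss = s ∷ ss} (𝓕._∷_ {a} {as} t ts) {xs} {ys} r =
    subst (Agree (s ∷ ss) (zero ∷ zeros ss) (E𝓕.evals (t 𝓕.∷ ts) xs))
          (sym (run-subst (λ l → 𝓖.Terms l (zero ∷ zeros ss)) (All Car) E𝓖.evals
                          q (erase t 𝓖.∷ erases ts) ys))
          (let (r₁ , r₂) = agree-++⁻ a xs _ (agree-subst q r) in sound t r₁ ∷ sounds ts r₂)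
    where q : zeros (a ++ as) ≡ zeros a ++ zeros as
          q = zeros-++ a as

module Subsequences (𝒜 : TwoPhyla) (hom : Alg.IsHomomorphism 𝒜)
                    (β : ℕ → Alg.A₀ 𝒜) (e : ℕ → Fin 2) (b : (i : ℕ) → Alg.Car 𝒜 (e i))
                    (match : (i : ℕ) → Alg.Matches 𝒜 (e i) (b i) (β i)) where
  open Alg 𝒜
  open Agreement 𝒜
  open Translation 𝒜 hom

  agree-select : (n : List ℕ) →
                 Agree (map e n) (zeros n) (E𝓕.select e b n) (E𝓖.select (λ _ → zero) β n)
  agree-select []      = []
  agree-select (i ∷ n) = match i ∷ agree-select n

  translate : (n : List ℕ) → 𝓕.Term (map e n) zero → 𝓖.Term (zeros n) zero
  translate n f = subst (λ l → 𝓖.Term l zero) (sym (zeros-map e n)) (erase f)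

  translate-correct : (n : List ℕ) (f : 𝓕.Term (map e n) zero) →
    E𝓕.eval f (E𝓕.select e b n) ≡ E𝓖.eval (translate n f) (E𝓖.select (λ _ → zero) β n)
  translate-correct n f =
    trans (sound f (agree-subst (zeros-map e n) (agree-select n)))
          (sym (run-subst (λ l → 𝓖.Term l zero) (All Car) E𝓖.eval (zeros-map e n) (erase f) _))

  translate-block : ∀ {x} → E𝓕.Block e b zero x → E𝓖.Block (λ _ → zero) β zero x
  translate-block B = record
    { idx  = E𝓕.idx B
    ; incr = E𝓕.incr B
    ; term = translate (E𝓕.idx B) (E𝓕.term B)
    ; eqn  = trans (E𝓕.eqn B) (translate-correct (E𝓕.idx B) (E𝓕.term B))
    }

mainTheorem11 : (𝒜 : TwoPhyla) → let open Alg 𝒜 in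
  IsHomomorphism →
  (β : ℕ → A₀) → ((i : ℕ) → ∃ λ a → h a ≡ β i) →
  (e : ℕ → Fin 2) → InΩ₀ e →
  (b : (i : ℕ) → Car (e i)) → ((i : ℕ) → Matches (e i) (b i) (β i)) →
  ((ss : List (Fin 2)) (f : 𝓕.Term ss zero) (n : List ℕ) → Linked _<_ n →
     (p : map e n ≡ ss) →
     ∃ λ (F′ : 𝓖.Term (map (λ _ → zero) n) zero) →
       E𝓕.eval f (subst (All Car) p (E𝓕.select e b n))
         ≡ E𝓖.eval F′ (E𝓖.select (λ _ → zero) β n))
  ×
  ((u : ℕ → A₀) → E𝓕.Below (λ _ → zero) u e b →
     E𝓖.Below (λ _ → zero) u (λ _ → zero) β)
mainTheorem11 𝒜 hom β _ e _ b match =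
  (λ { _ f n _ refl → translate n f , translate-correct n f }) ,
  (λ { _ (blocks , ordered) → (λ j → translate-block (blocks j)) , ordered })
  where open Subsequences 𝒜 hom β e b match
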